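{- Let $J$ be a jellyfish graph with head $H$ and legs isomorphic to the rooted tree $L$. If $L$ is rigid then $Fix(J)=Fix(H)$; otherwise $Fix(J)=|V(H)|\cdot Fix(L)$.
   Context: A subset $S\subseteq V(G)$ is a fixing set of $G$ if the only automorphism $\pi$ of $G$ with $\pi(s)=s$ for all $s\in S$ is the identity; $Fix(G)$ is the minimum size of a fixing set. For a rooted tree, automorphisms are required to fix the root, and the rooted tree is rigid if its only such automorphism is the identity (equivalently $Fix(L)=0$). A jellyfish graph $J$ is described by a graph $H$ (the head), which contains a Hamiltonian cycle, and a rooted tree $L$: for each vertex $v\in V(H)$ there is a leg $L_v$, a rooted tree with root $v$ isomorphic (as a rooted tree) to $L$; distinct legs are vertex-disjoint, $V(J)$ is the union of the legs, and $E(J)$ consists of the edges of $H$ together with the edges of all legs. -}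

module Defs where

open import Data.Nat using (ℕ; zero; suc; _+_; _*_; _≤_)
open import Data.Nat.DivMod using (_mod_)
open import Data.Fin using (Fin; toℕ; remQuot; _≟_)
open import Data.Fin.Subset using (Subset; _∈_; ∣_∣)
open import Data.Bool using (Bool; true; false; _∧_; _∨_)
open import Data.Product using (Σ; ∃; _×_; _,_)
open import Relation.Nullary.Decidable using (⌊_⌋)
open import Relation.Binary.PropositionalEquality using (_≡_)
open import Function.Definitions using (Injective; Surjective)
open import Data.Empty using (⊥)
open import Data.Unit using (⊤)

Graph : ℕ → Set
Graph n = Fin n → Fin n → Bool

Adj : ∀ {n} → Graph n → Fin n → Fin n → Set
Adj G i j = G i j ≡ true

record IsSimple {n : ℕ} (G : Graph n) : Set where
  field
    symmetric   : ∀ i j → G i j ≡ G j i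
    irreflexive : ∀ i → G i i ≡ false

record Aut {n : ℕ} (G : Graph n) : Set where
  field
    fun     : Fin n → Fin n
    inv     : Fin n → Fin n
    inv-l   : ∀ v → inv (fun v) ≡ v
    inv-r   : ∀ v → fun (inv v) ≡ v
    preserv : ∀ i j → G (fun i) (fun j) ≡ G i j
open Aut public

IsFixingSetWrt : ∀ {n} (G : Graph n) → (Aut G → Set) → Subset n → Set
IsFixingSetWrt {n} G R S =
  (π : Aut G) → R π → (∀ s → s ∈ S → fun π s ≡ s) → ∀ v → fun π v ≡ v

IsFixWrt : ∀ {n} (G : Graph n) → (Aut G → Set) → ℕ → Set
IsFixWrt {n} G R k =
  (Σ (Subset n) λ S → IsFixingSetWrt G R S × ∣ S ∣ ≡ k)
  × (∀ (S : Subset n) → IsFixingSetWrt G R S → k ≤ ∣ S ∣)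

IsFix : ∀ {n} → Graph n → ℕ → Set
IsFix G k = IsFixWrt G (λ _ → ⊤) k

record Cycle {n : ℕ} (G : Graph n) : Set where
  field
    len'   : ℕ
    vtx    : Fin (3 + len') → Fin n
    inj    : Injective _≡_ _≡_ vtx
    closed : ∀ (i : Fin (3 + len')) → Adj G (vtx i) (vtx ((suc (toℕ i)) mod (3 + len')))
open Cycle public

record HamiltonianCycle {n : ℕ} (G : Graph n) : Set where
  field
    cycle    : Cycle G
    spanning : ∀ (v : Fin n) → ∃ λ i → vtx cycle i ≡ v

data Walk {n : ℕ} (G : Graph n) : Fin n → Fin n → Set where
  [] : ∀ {i} → Walk G i i
  _∷_ : ∀ {i j k} → Adj G i j → Walk G j k → Walk G i k

Connected : ∀ {n} → Graph n → Set
Connected G = ∀ i j → Walk G i j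

Acyclic : ∀ {n} → Graph n → Set
Acyclic G = Cycle G → ⊥

record IsTree {n : ℕ} (G : Graph n) : Set where
  field
    simple    : IsSimple G
    connected : Connected G
    acyclic   : Acyclic G

record RootedTree : Set where
  field
    size : ℕ
    tree : Graph size
    isTree : IsTree tree
    root : Fin size
open RootedTree public

RootFixing : (L : RootedTree) → Aut (tree L) → Set
RootFixing L π = fun π (root L) ≡ root L

Rigid : RootedTree → Set
Rigid L = (π : Aut (tree L)) → RootFixing L π → ∀ v → fun π v ≡ v

IsFixRooted : RootedTree → ℕ → Set
IsFixRooted L k = IsFixWrt (tree L) (RootFixing L) k

-- Vertex (v , x) ∈ Fin n × Fin (size L) is encoded as Fin (n * size L)
-- via remQuot/combine; the leg L_v is {v} × Fin (size L) with root (v , root L).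
_==_ : ∀ {n} → Fin n → Fin n → Bool
i == j = ⌊ i ≟ j ⌋

jellyAdj : ∀ {n} (H : Graph n) (L : RootedTree) →
           Fin n × Fin (size L) → Fin n × Fin (size L) → Bool
jellyAdj H L (v , x) (w , y) =
  ((v == w) ∧ tree L x y) ∨ (H v w ∧ ((x == root L) ∧ (y == root L)))

jellyfish : ∀ {n} (H : Graph n) (L : RootedTree) → Graph (n * size L)
jellyfish {n} H L a b = jellyAdj H L (remQuot {n} (size L) a) (remQuot {n} (size L) b)

-- A cycle of the jellyfish J can enter or leave a leg only through its root, so every
-- cycle of J lies in the head. Hence an automorphism of J sends the Hamiltonian cycle of
-- the head to a cycle, i.e. roots to roots; since legs are connected and only roots have
-- neighbours in other legs, it also sends legs to legs. So the automorphisms of J are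
-- exactly the maps (v , x) ↦ (ρ v , α_v x) with ρ ∈ Aut H and α_v root-fixing
-- automorphisms of L. If L is rigid all α_v are trivial: a fixing set of H placed at the
-- roots fixes J, and a fixing set of J projects onto a fixing set of H that is no larger.
-- Otherwise a minimum fixing set of L placed in every leg fixes J (being nonempty it also
-- pins down ρ), and a fixing set of J meets every leg in a fixing set of L, because an
-- automorphism of one leg extends to J by the identity on the other legs.
module Submission where

open import Defs
open import Level using (Level)
open import Data.Nat using (ℕ; zero; suc; _+_; _*_; _≤_; _<_; _≤?_; z≤n; s≤s; NonZero; _%_; _/_)
open import Data.Nat.Properties using (≤-refl; ≤-trans; ≤-antisym; ≤-pred; <⇒≤; ≤∧≢⇒<; ≰⇒≥; m≤n⇒m≤1+n; m≤n+m; +-assoc; +-comm; +-mono-≤; +-monoˡ-≤; +-monoʳ-≤; +-cancelˡ-<; +-cancelʳ-≤; *-monoˡ-≤; *-cancelʳ-<; *-identityʳ; module ≤-Reasoning)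
open import Data.Nat.DivMod using (_mod_; m≡m%n+[m/n]*n; m%n<n; m%n%n≡m%n; %-distribˡ-+; [m+n]%n≡m%n; m<n⇒m%n≡m)
open import Data.Bool using (Bool; true; false; _∧_; _∨_; if_then_else_)
open import Data.Bool.Properties using (∧-zeroʳ; ∧-identityʳ; ∨-identityʳ)
open import Data.Fin as Fin using (Fin; toℕ; combine; remQuot; _≟_)
open import Data.Fin.Properties using (toℕ-injective; toℕ-fromℕ<; toℕ<n; remQuot-combine; combine-remQuot)
open import Data.Fin.Subset using (Subset; Nonempty; _∈_; ∣_∣; ⁅_⁆; ⊥; ⊤; outside; inside)
open import Data.Fin.Subset.Properties using (x∈⁅x⁆; ∣⁅x⁆∣≡1; ∣⊥∣≡0; ∣⊤∣≡n; ∈⊤; nonempty?; x∈p⇒∣p-x∣<∣p∣)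
open import Data.Vec using (Vec; []; _∷_; lookup; tabulate; concat; map; _++_)
open import Data.Vec.Properties using (lookup-concat; lookup-map; lookup∘tabulate; tabulate∘lookup; tabulate-cong; []=⇒lookup; lookup⇒[]=)
open import Data.Product using (Σ; ∃-syntax; _×_; _,_; proj₁; proj₂; uncurry)
open import Data.Unit using (tt) renaming (⊤ to Unit)
open import Function using (_∘_; id)
open import Relation.Nullary using (¬_; yes; no; does; contradiction)
open import Relation.Nullary.Decidable using (¬?; decidable-stable; dec-true)
open import Relation.Unary using (Pred; Decidable)
open import Relation.Binary.PropositionalEquality hiding (J)

private variable
  ℓ : Level
  k m n : ℕ

==-refl : ∀ (a : Fin m) → (a == a) ≡ true
==-refl a with a ≟ a
... | yes _   = refl
... | no a≢a = contradiction refl a≢a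

==-cong : ∀ {a b : Fin m} {c d : Fin k} → (a ≡ b → c ≡ d) → (c ≡ d → a ≡ b) → (a == b) ≡ (c == d)
==-cong {a = a} {b} {c} {d} to from with a ≟ b | c ≟ d
... | yes _   | yes _   = refl
... | yes a≡b | no c≢d = contradiction (to a≡b) c≢d
... | no a≢b | yes c≡d = contradiction (from c≡d) a≢b
... | no _    | no _    = refl

invAut : ∀ {G : Graph m} → Aut G → Aut G
invAut {G = G} σ = record
  { fun = inv σ ; inv = fun σ ; inv-l = inv-r σ ; inv-r = inv-l σ
  ; preserv = λ i j → trans (sym (preserv σ (inv σ i) (inv σ j))) (cong₂ G (inv-r σ i) (inv-r σ j))
  }

idAut : ∀ {G : Graph m} → Aut G
idAut = record { fun = id ; inv = id ; inv-l = λ _ → refl ; inv-r = λ _ → refl ; preserv = λ _ _ → refl }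

fun-injective : ∀ {G : Graph m} (σ : Aut G) {a b} → fun σ a ≡ fun σ b → a ≡ b
fun-injective σ {a} {b} e = trans (sym (inv-l σ a)) (trans (cong (inv σ) e) (inv-l σ b))

==-fun : ∀ {G : Graph m} (σ : Aut G) a b → (fun σ a == fun σ b) ≡ (a == b)
==-fun σ a b = ==-cong (fun-injective σ) (cong (fun σ))

mapCycle : ∀ {G : Graph m} → Aut G → Cycle G → Cycle G
mapCycle σ c = record
  { len'   = len' c
  ; vtx    = fun σ ∘ vtx c
  ; inj    = inj c ∘ fun-injective σ
  ; closed = λ i → trans (preserv σ _ _) (closed c i)
  }

IsFixingSet : Graph m → Subset m → Set
IsFixingSet G = IsFixingSetWrt G (λ _ → Unit)

fixing-set-nonempty : ∀ {L : RootedTree} {T₀} → ¬ Rigid L → IsFixingSetWrt (tree L) (RootFixing L) T₀ → Nonempty T₀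
fixing-set-nonempty {T₀ = T₀} L-nonrigid T₀-fixes with nonempty? T₀
... | yes element = element
... | no  empty   =
  contradiction (λ π π-root → T₀-fixes π π-root (λ x x∈T₀ → contradiction (x , x∈T₀) empty)) L-nonrigid

exit-between : {P : Pred ℕ ℓ} → Decidable P → ∀ {a b} → a ≤ b → P a → ¬ P b →
               ∃[ t ] a ≤ t × t < b × P t × ¬ P (suc t)
exit-between P? {b = zero} z≤n Pa ¬Pb = contradiction Pa ¬Pb
exit-between P? {b = suc b} a≤1+b Pa ¬P1+b
  with P? b | ≤-pred (≤∧≢⇒< a≤1+b λ { refl → ¬P1+b Pa })
... | yes Pb | a≤b = b , a≤b , ≤-refl , Pb , ¬P1+b
... | no ¬Pb | a≤b with exit-between P? a≤b Pa ¬Pb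
...   | t , a≤t , t<b , Pt , ¬P1+t = t , a≤t , m≤n⇒m≤1+n t<b , Pt , ¬P1+t

entry-between : {P : Pred ℕ ℓ} → Decidable P → ∀ {a b} → a ≤ b → ¬ P a → P b →
                ∃[ t ] a ≤ t × t < b × ¬ P t × P (suc t)
entry-between P? a≤b ¬Pa Pb with exit-between (¬? ∘ P?) a≤b ¬Pa (λ ¬Pb → ¬Pb Pb)
... | t , a≤t , t<b , ¬Pt , ¬¬P1+t = t , a≤t , t<b , ¬Pt , decidable-stable (P? (suc t)) ¬¬P1+t

m<n⇒m%o≡n%o⇒m+o≤n : ∀ o .{{_ : NonZero o}} {m n} → m < n → m % o ≡ n % o → m + o ≤ n
m<n⇒m%o≡n%o⇒m+o≤n o {m} {n} m<n m%o≡n%o = begin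
  m + o                    ≡⟨ cong (_+ o) (m≡m%n+[m/n]*n m o) ⟩
  m % o + m / o * o + o    ≡⟨ +-assoc (m % o) (m / o * o) o ⟩
  m % o + (m / o * o + o)  ≡⟨ cong (m % o +_) (+-comm (m / o * o) o) ⟩
  m % o + suc (m / o) * o  ≤⟨ +-monoʳ-≤ (m % o) (*-monoˡ-≤ o m/o<n/o) ⟩
  m % o + n / o * o        ≡⟨ cong (_+ n / o * o) m%o≡n%o ⟩
  n % o + n / o * o        ≡⟨ m≡m%n+[m/n]*n n o ⟨
  n                        ∎
  where
  open ≤-Reasoning
  m/o<n/o : m / o < n / o
  m/o<n/o = *-cancelʳ-< o (m / o) (n / o) (+-cancelˡ-< (m % o) _ _ (subst₂ _<_
    (m≡m%n+[m/n]*n m o) (trans (m≡m%n+[m/n]*n n o) (cong (_+ n / o * o) (sym m%o≡n%o))) m<n))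

module _ {A : Set} {m : ℕ} .{{_ : NonZero m}} (g : ℕ → A)
         (g-periodic : ∀ t → g (t + m) ≡ g t)
         (g-injective : ∀ t u → g t ≡ g u → t % m ≡ u % m)
         {Q : Pred A ℓ} (Q? : Decidable Q) (z : A)
         (exits-at-z   : ∀ t → Q (g t) → ¬ Q (g (suc t)) → g t ≡ z)
         (enters-at-z  : ∀ t → ¬ Q (g t) → Q (g (suc t)) → g (suc t) ≡ z) where

  -- Leaving Q after a and returning before a + m passes z twice; injectivity forces both passages to be at a.
  gate-at-start : ∀ {a b} → a ≤ b → b ≤ a + m → Q (g a) → ¬ Q (g b) → g a ≡ z
  gate-at-start {a} {b} a≤b b≤a+m Qa ¬Qb
    with exit-between (Q? ∘ g) a≤b Qa ¬Qb
       | entry-between (Q? ∘ g) b≤a+m ¬Qb (subst Q (sym (g-periodic a)) Qa)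
  ... | t , a≤t , t<b , Qt , ¬Q1+t | u , b≤u , u<a+m , ¬Qu , Q1+u = subst (λ s → g s ≡ z) t≡a gt≡z
    where
    gt≡z : g t ≡ z
    gt≡z = exits-at-z t Qt ¬Q1+t
    t+m≤1+u : t + m ≤ suc u
    t+m≤1+u = m<n⇒m%o≡n%o⇒m+o≤n m (s≤s (≤-trans (<⇒≤ t<b) b≤u))
                (g-injective t (suc u) (trans gt≡z (sym (enters-at-z u ¬Qu Q1+u))))
    t≡a : t ≡ a
    t≡a = ≤-antisym (+-cancelʳ-≤ m t a (≤-trans t+m≤1+u u<a+m)) a≤t

  confined-by-gate : ∀ {a b} → a < m → b < m → Q (g a) → g a ≢ z → Q (g b)
  confined-by-gate {a} {b} a<m b<m Qa ga≢z = decidable-stable (Q? (g b)) ¬¬Qb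
    where
    ¬¬Qb : ¬ ¬ Q (g b)
    ¬¬Qb ¬Qb with a ≤? b
    ... | yes a≤b = ga≢z (gate-at-start a≤b (≤-trans (<⇒≤ b<m) (m≤n+m m a)) Qa ¬Qb)
    ... | no  a≰b = ga≢z (gate-at-start (≤-trans (<⇒≤ a<m) (m≤n+m m b)) (+-monoˡ-≤ m (≰⇒≥ a≰b)) Qa
                                         (λ Qb+m → ¬Qb (subst Q (g-periodic b) Qb+m)))

module _ {N : ℕ} {G : Graph N} (c : Cycle G) where

  private
    len : ℕ
    len = 3 + len' c

    toℕ-mod : ∀ t → toℕ (t mod len) ≡ t % len
    toℕ-mod t = toℕ-fromℕ< (m%n<n t len)

    mod-cong : ∀ t u → t % len ≡ u % len → t mod len ≡ u mod len
    mod-cong t u e = toℕ-injective (trans (toℕ-mod t) (trans e (sym (toℕ-mod u))))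

  around : ℕ → Fin N
  around t = vtx c (t mod len)

  around-periodic : ∀ t → around (t + len) ≡ around t
  around-periodic t = cong (vtx c) (mod-cong (t + len) t ([m+n]%n≡m%n t len))

  around-injective : ∀ t u → around t ≡ around u → t % len ≡ u % len
  around-injective t u e = trans (sym (toℕ-mod t)) (trans (cong toℕ (inj c e)) (toℕ-mod u))

  around-toℕ : ∀ i → around (toℕ i) ≡ vtx c i
  around-toℕ i = cong (vtx c) (toℕ-injective (trans (toℕ-mod (toℕ i)) (m<n⇒m%n≡m (toℕ<n i))))

  around-step : ∀ t → Adj G (around t) (around (suc t))
  around-step t = subst (λ i → Adj G (around t) (vtx c i))
    (mod-cong (suc (toℕ (t mod len))) (suc t) 1+[t%len]≡1+t) (closed c (t mod len))
    where
    open ≡-Reasoning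
    1+[t%len]≡1+t : suc (toℕ (t mod len)) % len ≡ suc t % len
    1+[t%len]≡1+t = begin
      suc (toℕ (t mod len)) % len      ≡⟨ cong (λ k → suc k % len) (toℕ-mod t) ⟩
      (1 + t % len) % len              ≡⟨ %-distribˡ-+ 1 (t % len) len ⟩
      (1 % len + t % len % len) % len  ≡⟨ cong (λ k → (1 % len + k) % len) (m%n%n≡m%n t len) ⟩
      (1 % len + t % len) % len        ≡⟨ %-distribˡ-+ 1 t len ⟨
      suc t % len                      ∎

∣p++q∣≡∣p∣+∣q∣ : ∀ {l} (p : Subset k) (q : Subset l) → ∣ p ++ q ∣ ≡ ∣ p ∣ + ∣ q ∣
∣p++q∣≡∣p∣+∣q∣ []            q = refl
∣p++q∣≡∣p∣+∣q∣ (inside  ∷ p) q = cong suc (∣p++q∣≡∣p∣+∣q∣ p q)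
∣p++q∣≡∣p∣+∣q∣ (outside ∷ p) q = ∣p++q∣≡∣p∣+∣q∣ p q

∈-concat⁺ : ∀ {xss : Vec (Subset m) n} {v x} → x ∈ lookup xss v → combine v x ∈ concat xss
∈-concat⁺ {xss = xss} {v} {x} x∈ = lookup⇒[]= (combine v x) (concat xss) (trans (lookup-concat xss v x) ([]=⇒lookup x∈))

_⊗_ : Subset n → Subset m → Subset (n * m)
P ⊗ Q = concat (map (λ b → if b then Q else ⊥) P)

∣P⊗Q∣≡∣P∣*∣Q∣ : ∀ (P : Subset n) (Q : Subset m) → ∣ P ⊗ Q ∣ ≡ ∣ P ∣ * ∣ Q ∣
∣P⊗Q∣≡∣P∣*∣Q∣ []            Q = refl
∣P⊗Q∣≡∣P∣*∣Q∣ (inside  ∷ P) Q = trans (∣p++q∣≡∣p∣+∣q∣ Q (P ⊗ Q)) (cong (∣ Q ∣ +_) (∣P⊗Q∣≡∣P∣*∣Q∣ P Q))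
∣P⊗Q∣≡∣P∣*∣Q∣ {m = m} (outside ∷ P) Q =
  trans (∣p++q∣≡∣p∣+∣q∣ (⊥ {m}) (P ⊗ Q)) (cong₂ _+_ (∣⊥∣≡0 m) (∣P⊗Q∣≡∣P∣*∣Q∣ P Q))

∈-⊗⁺ : ∀ {P : Subset n} {Q : Subset m} {v x} → v ∈ P → x ∈ Q → combine v x ∈ P ⊗ Q
∈-⊗⁺ {P = P} {Q} {v} v∈P x∈Q = ∈-concat⁺ {xss = map (λ b → if b then Q else ⊥) P} (subst (_ ∈_) (sym Q≡) x∈Q)
  where
  Q≡ : lookup (map (λ b → if b then Q else ⊥) P) v ≡ Q
  Q≡ = trans (lookup-map v _ P) (cong (λ b → if b then Q else ⊥) ([]=⇒lookup v∈P))

n*k≤∣concat∣ : ∀ (xss : Vec (Subset m) n) → (∀ v → k ≤ ∣ lookup xss v ∣) → n * k ≤ ∣ concat xss ∣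
n*k≤∣concat∣ []         k≤ = z≤n
n*k≤∣concat∣ (xs ∷ xss) k≤ =
  subst (_ ≤_) (sym (∣p++q∣≡∣p∣+∣q∣ xs (concat xss)))
    (+-mono-≤ (k≤ Fin.zero) (n*k≤∣concat∣ xss (k≤ ∘ Fin.suc)))

∣nonempty?∷q∣≤∣p∣+∣q∣ : ∀ {l} (p : Subset m) (q : Subset l) → ∣ does (nonempty? p) ∷ q ∣ ≤ ∣ p ∣ + ∣ q ∣
∣nonempty?∷q∣≤∣p∣+∣q∣ p q with nonempty? p
... | yes (x , x∈p) = +-monoˡ-≤ ∣ q ∣ (≤-trans (s≤s z≤n) (x∈p⇒∣p-x∣<∣p∣ x∈p))
... | no  _         = m≤n+m ∣ q ∣ ∣ p ∣

∣map-nonempty?∣≤∣concat∣ : ∀ (xss : Vec (Subset m) n) → ∣ map (does ∘ nonempty?) xss ∣ ≤ ∣ concat xss ∣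
∣map-nonempty?∣≤∣concat∣ []         = z≤n
∣map-nonempty?∣≤∣concat∣ (xs ∷ xss) = begin
  ∣ does (nonempty? xs) ∷ map (does ∘ nonempty?) xss ∣  ≤⟨ ∣nonempty?∷q∣≤∣p∣+∣q∣ xs (map (does ∘ nonempty?) xss) ⟩
  ∣ xs ∣ + ∣ map (does ∘ nonempty?) xss ∣               ≤⟨ +-monoʳ-≤ ∣ xs ∣ (∣map-nonempty?∣≤∣concat∣ xss) ⟩
  ∣ xs ∣ + ∣ concat xss ∣                               ≡⟨ ∣p++q∣≡∣p∣+∣q∣ xs (concat xss) ⟨
  ∣ xs ++ concat xss ∣                                  ∎
  where open ≤-Reasoning

module Slices {n s : ℕ} where

  slice : Subset (n * s) → Fin n → Subset s
  slice S v = tabulate (λ x → lookup S (combine v x))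

  concat-slices : ∀ (S : Subset (n * s)) → concat (tabulate (slice S)) ≡ S
  concat-slices S = begin
    concat (tabulate (slice S))                      ≡⟨ tabulate∘lookup _ ⟨
    tabulate (lookup (concat (tabulate (slice S))))  ≡⟨ tabulate-cong same-entries ⟩
    tabulate (lookup S)                              ≡⟨ tabulate∘lookup S ⟩
    S                                                ∎
    where
    open ≡-Reasoning
    same-entries : ∀ a → lookup (concat (tabulate (slice S))) a ≡ lookup S a
    same-entries a = subst (λ b → lookup (concat (tabulate (slice S))) b ≡ lookup S b)
                           (combine-remQuot {n} s a) (uncurry at-combine (remQuot {n} s a))
      where
      at-combine : ∀ v x → lookup (concat (tabulate (slice S))) (combine v x) ≡ lookup S (combine v x)
      at-combine v x = begin
        lookup (concat (tabulate (slice S))) (combine v x)  ≡⟨ lookup-concat (tabulate (slice S)) v x ⟩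
        lookup (lookup (tabulate (slice S)) v) x            ≡⟨ cong (λ p → lookup p x) (lookup∘tabulate (slice S) v) ⟩
        lookup (slice S v) x                                ≡⟨ lookup∘tabulate _ x ⟩
        lookup S (combine v x)                              ∎

  ∈-slice⁺ : ∀ {S : Subset (n * s)} {v x} → combine v x ∈ S → x ∈ slice S v
  ∈-slice⁺ {S} {v} {x} vx∈S = lookup⇒[]= x (slice S v) (trans (lookup∘tabulate _ x) ([]=⇒lookup vx∈S))

  shadow : Subset (n * s) → Subset n
  shadow S = map (does ∘ nonempty?) (tabulate (slice S))

  ∈-shadow⁺ : ∀ {S : Subset (n * s)} {v x} → combine v x ∈ S → v ∈ shadow S
  ∈-shadow⁺ {S} {v} {x} vx∈S = lookup⇒[]= v (shadow S) (begin
    lookup (shadow S) v                               ≡⟨ lookup-map v _ (tabulate (slice S)) ⟩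
    does (nonempty? (lookup (tabulate (slice S)) v))  ≡⟨ cong (does ∘ nonempty?) (lookup∘tabulate (slice S) v) ⟩
    does (nonempty? (slice S v))                      ≡⟨ dec-true (nonempty? (slice S v)) (x , ∈-slice⁺ vx∈S) ⟩
    true                                              ∎)
    where open ≡-Reasoning

  ∣shadow∣≤∣S∣ : ∀ (S : Subset (n * s)) → ∣ shadow S ∣ ≤ ∣ S ∣
  ∣shadow∣≤∣S∣ S = subst (∣ shadow S ∣ ≤_) (cong ∣_∣ (concat-slices S))
    (∣map-nonempty?∣≤∣concat∣ (tabulate (slice S)))

  n*k≤∣S∣ : ∀ {k} (S : Subset (n * s)) → (∀ v → k ≤ ∣ slice S v ∣) → n * k ≤ ∣ S ∣
  n*k≤∣S∣ S k≤ = subst (_ ≤_) (cong ∣_∣ (concat-slices S))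
    (n*k≤∣concat∣ (tabulate (slice S)) (λ v → subst (_ ≤_) (cong ∣_∣ (sym (lookup∘tabulate (slice S) v))) (k≤ v)))

module Jellyfish {n : ℕ} (H : Graph n) (H-simple : IsSimple H) (L : RootedTree) where

  private
    s : ℕ
    s = size L

    r : Fin s
    r = root L

    T : Graph s
    T = tree L

  Vertex : Set
  Vertex = Fin n × Fin s

  J : Graph (n * s)
  J = jellyfish H L

  enc : Vertex → Fin (n * s)
  enc = uncurry combine

  dec : Fin (n * s) → Vertex
  dec = remQuot {n} s

  dec-enc : ∀ p → dec (enc p) ≡ p
  dec-enc = uncurry remQuot-combine

  enc-dec : ∀ a → enc (dec a) ≡ a
  enc-dec = combine-remQuot {n} s

  dec-injective : ∀ {a b} → dec a ≡ dec b → a ≡ b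
  dec-injective {a} {b} e = trans (sym (enc-dec a)) (trans (cong enc e) (enc-dec b))

  enc-injective : ∀ {p q} → enc p ≡ enc q → p ≡ q
  enc-injective {p} {q} e = trans (sym (dec-enc p)) (trans (cong dec e) (dec-enc q))

  pairwise : ∀ {P : Fin (n * s) → Set} → (∀ v x → P (enc (v , x))) → ∀ a → P a
  pairwise {P} P-enc a = subst P (enc-dec a) (uncurry P-enc (dec a))

  data JellyEdge : Vertex → Vertex → Set where
    leg-edge  : ∀ {v x y} → Adj T x y → JellyEdge (v , x) (v , y)
    head-edge : ∀ {v w} → Adj H v w → JellyEdge (v , r) (w , r)

  private
    head-part-edge : ∀ v w x y → H v w ∧ ((x == r) ∧ (y == r)) ≡ true → JellyEdge (v , x) (w , y)
    head-part-edge v w x y e with H v w in Hvw | x ≟ r | y ≟ r | e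
    ... | true  | yes refl | yes refl | _ = head-edge Hvw
    ... | true  | yes refl | no _     | ()
    ... | true  | no _     | _        | ()
    ... | false | _        | _        | ()

  jellyEdge : ∀ p q → jellyAdj H L p q ≡ true → JellyEdge p q
  jellyEdge (v , x) (w , y) e with v ≟ w | T x y in Txy
  ... | yes refl | true  = leg-edge Txy
  ... | yes refl | false = head-part-edge v v x y e
  ... | no _     | _     = head-part-edge v w x y e

  private
    T-irreflexive : ∀ x → T x x ≡ false
    T-irreflexive = IsSimple.irreflexive (IsTree.simple (isTree L))

    H-irreflexive : ∀ v → H v v ≡ false
    H-irreflexive = IsSimple.irreflexive H-simple

  jellyAdj-leg : ∀ v x y → jellyAdj H L (v , x) (v , y) ≡ T x y
  jellyAdj-leg v x y rewrite ==-refl v | H-irreflexive v = ∨-identityʳ (T x y)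

  jellyAdj-head : ∀ v w → jellyAdj H L (v , r) (w , r) ≡ H v w
  jellyAdj-head v w rewrite T-irreflexive r | ==-refl r | ∧-zeroʳ (v == w) = ∧-identityʳ (H v w)

  cross-leg-edge : ∀ {p q} → JellyEdge p q → proj₁ p ≢ proj₁ q → proj₂ p ≡ r × proj₂ q ≡ r
  cross-leg-edge (leg-edge _)  v≢v = contradiction refl v≢v
  cross-leg-edge (head-edge _) _   = refl , refl

  within-leg-edge : ∀ {p q} → JellyEdge p q → proj₁ p ≡ proj₁ q → Adj T (proj₂ p) (proj₂ q)
  within-leg-edge (leg-edge Txy)       _    = Txy
  within-leg-edge (head-edge {v} Hvv) refl = contradiction (trans (sym Hvv) (H-irreflexive v)) λ ()

  leg-cycle : (c : Cycle J) (v : Fin n) → (∀ i → proj₁ (dec (vtx c i)) ≡ v) → Cycle T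
  leg-cycle c v in-leg = record
    { len'   = len' c
    ; vtx    = proj₂ ∘ dec ∘ vtx c
    ; inj    = λ {i} {j} e → inj c (dec-injective (cong₂ _,_ (trans (in-leg i) (sym (in-leg j))) e))
    ; closed = λ i → within-leg-edge (jellyEdge _ _ (closed c i)) (trans (in-leg i) (sym (in-leg _)))
    }

  -- A cycle can enter and leave the leg L_v only through its root (v , r).
  cycle-in-roots : (c : Cycle J) → ∀ i → proj₂ (dec (vtx c i)) ≡ r
  cycle-in-roots c i with proj₂ (dec (vtx c i)) ≟ r
  ... | yes on-root = on-root
  ... | no off-root = contradiction (leg-cycle c v in-leg) (IsTree.acyclic (isTree L))
    where
    v : Fin n
    v = proj₁ (dec (vtx c i))

    g : ℕ → Vertex
    g = dec ∘ around c

    exits : ∀ t → proj₁ (g t) ≡ v → proj₁ (g (suc t)) ≢ v → g t ≡ (v , r)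
    exits t in-t out-1+t =
      cong₂ _,_ in-t (proj₁ (cross-leg-edge (jellyEdge _ _ (around-step c t)) (λ e → out-1+t (trans (sym e) in-t))))

    enters : ∀ t → proj₁ (g t) ≢ v → proj₁ (g (suc t)) ≡ v → g (suc t) ≡ (v , r)
    enters t out-t in-1+t =
      cong₂ _,_ in-1+t (proj₂ (cross-leg-edge (jellyEdge _ _ (around-step c t)) (λ e → out-t (trans e in-1+t))))

    gi≡vtx : ∀ j → g (toℕ j) ≡ dec (vtx c j)
    gi≡vtx j = cong dec (around-toℕ c j)

    in-leg : ∀ j → proj₁ (dec (vtx c j)) ≡ v
    in-leg j = subst (λ p → proj₁ p ≡ v) (gi≡vtx j)
      (confined-by-gate g (cong dec ∘ around-periodic c) (λ t u → around-injective c t u ∘ dec-injective)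
         (λ p → proj₁ p ≟ v) (v , r) exits enters (toℕ<n i) (toℕ<n j)
         (cong proj₁ (gi≡vtx i)) (λ e → off-root (cong proj₂ (trans (sym (gi≡vtx i)) e))))

  ==root-invariant : ∀ (π : Aut T) → RootFixing L π → ∀ x → (fun π x == r) ≡ (x == r)
  ==root-invariant π π-root x = trans (cong (fun π x ==_) (sym π-root)) (==-fun π x r)

  jellyAut : (ρ : Aut H) (α : Fin n → Aut T) → (∀ v → RootFixing L (α v)) → Aut J
  jellyAut ρ α α-root = record
    { fun     = enc ∘ g ∘ dec
    ; inv     = enc ∘ h ∘ dec
    ; inv-l   = λ a → trans (cong (enc ∘ h) (dec-enc (g (dec a)))) (trans (cong enc (h∘g (dec a))) (enc-dec a))
    ; inv-r   = λ a → trans (cong (enc ∘ g) (dec-enc (h (dec a)))) (trans (cong enc (g∘h (dec a))) (enc-dec a))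
    ; preserv = λ a b → trans (cong₂ (jellyAdj H L) (dec-enc (g (dec a))) (dec-enc (g (dec b)))) (g-adj (dec a) (dec b))
    }
    where
    g h : Vertex → Vertex
    g (v , x) = fun ρ v , fun (α v) x
    h (v , x) = inv ρ v , inv (α (inv ρ v)) x

    h∘g : ∀ p → h (g p) ≡ p
    h∘g (v , x) rewrite inv-l ρ v = cong (v ,_) (inv-l (α v) x)

    g∘h : ∀ p → g (h p) ≡ p
    g∘h (v , x) = cong₂ _,_ (inv-r ρ v) (inv-r (α (inv ρ v)) x)

    leg-part : ∀ v w x y → ((v == w) ∧ T (fun (α v) x) (fun (α w) y)) ≡ ((v == w) ∧ T x y)
    leg-part v w x y with v ≟ w
    ... | yes refl = preserv (α v) x y
    ... | no _     = refl

    g-adj : ∀ p q → jellyAdj H L (g p) (g q) ≡ jellyAdj H L p q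
    g-adj (v , x) (w , y)
      rewrite ==-fun ρ v w | preserv ρ v w
            | ==root-invariant (α v) (α-root v) x | ==root-invariant (α w) (α-root w) y
      = cong (_∨ (H v w ∧ ((x == r) ∧ (y == r)))) (leg-part v w x y)

  jellyAut-enc : ∀ ρ α α-root v x → fun (jellyAut ρ α α-root) (enc (v , x)) ≡ enc (fun ρ v , fun (α v) x)
  jellyAut-enc ρ α α-root v x = cong (λ p → enc (fun ρ (proj₁ p) , fun (α (proj₁ p)) (proj₂ p))) (dec-enc (v , x))

  onPairs : Aut J → Vertex → Vertex
  onPairs σ = dec ∘ fun σ ∘ enc

  onPairs-adj : ∀ σ p q → jellyAdj H L (onPairs σ p) (onPairs σ q) ≡ jellyAdj H L p q
  onPairs-adj σ p q = trans (preserv σ (enc p) (enc q)) (cong₂ (jellyAdj H L) (dec-enc p) (dec-enc q))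

  onPairs-inverse : ∀ σ p → onPairs (invAut σ) (onPairs σ p) ≡ p
  onPairs-inverse σ p = trans (cong (dec ∘ inv σ) (enc-dec _)) (trans (cong dec (inv-l σ (enc p))) (dec-enc p))

  onPairs-fixed : ∀ σ p → fun σ (enc p) ≡ enc p → onPairs σ p ≡ p
  onPairs-fixed σ p σp≡p = trans (cong dec σp≡p) (dec-enc p)

  identity-onPairs : ∀ σ → (∀ p → onPairs σ p ≡ p) → ∀ a → fun σ a ≡ a
  identity-onPairs σ fixed a = subst (λ b → fun σ b ≡ a) (enc-dec a) (dec-injective (fixed (dec a)))

  open Slices {n} {s}

  shadow-fixing : ∀ {S} → IsFixingSet J S → IsFixingSet H (shadow S)
  shadow-fixing {S} S-fixes ρ _ ρ-fixes v =
    cong proj₁ (enc-injective (trans (sym (σ-enc v r)) (S-fixes σ tt σ-fixes (enc (v , r)))))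
    where
    σ : Aut J
    σ = jellyAut ρ (λ _ → idAut) (λ _ → refl)

    σ-enc : ∀ v x → fun σ (enc (v , x)) ≡ enc (fun ρ v , x)
    σ-enc = jellyAut-enc ρ (λ _ → idAut) (λ _ → refl)

    σ-fixes : ∀ a → a ∈ S → fun σ a ≡ a
    σ-fixes = pairwise λ v x vx∈S → trans (σ-enc v x) (cong (λ w → enc (w , x)) (ρ-fixes v (∈-shadow⁺ vx∈S)))

  slice-fixing : ∀ {S} → IsFixingSet J S → ∀ v → IsFixingSetWrt T (RootFixing L) (slice S v)
  slice-fixing {S} S-fixes v π π-root π-fixes x = subst (λ b → fun (π-if b) x ≡ x) (==-refl v)
    (cong proj₂ (enc-injective (trans (sym (σ-enc v x)) (S-fixes σ tt σ-fixes (enc (v , x))))))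
    where
    π-if : Bool → Aut T
    π-if b = if b then π else idAut

    π-if-root : ∀ b → RootFixing L (π-if b)
    π-if-root true  = π-root
    π-if-root false = refl

    σ : Aut J
    σ = jellyAut idAut (λ w → π-if (w == v)) (λ w → π-if-root (w == v))

    σ-enc : ∀ w y → fun σ (enc (w , y)) ≡ enc (w , fun (π-if (w == v)) y)
    σ-enc = jellyAut-enc idAut (λ w → π-if (w == v)) (λ w → π-if-root (w == v))

    π-if-fixes : ∀ w y → enc (w , y) ∈ S → fun (π-if (w == v)) y ≡ y
    π-if-fixes w y wy∈S with w ≟ v
    ... | yes refl = π-fixes y (∈-slice⁺ wy∈S)
    ... | no  _    = refl

    σ-fixes : ∀ a → a ∈ S → fun σ a ≡ a
    σ-fixes = pairwise λ w y wy∈S → trans (σ-enc w y) (cong (λ z → enc (w , z)) (π-if-fixes w y wy∈S))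

  module _ (ham : HamiltonianCycle H) where

    private
      C : Cycle H
      C = HamiltonianCycle.cycle ham

    headCycle : Cycle J
    headCycle = record
      { len'   = len' C
      ; vtx    = λ i → enc (vtx C i , r)
      ; inj    = λ e → inj C (cong proj₁ (trans (sym (dec-enc _)) (trans (cong dec e) (dec-enc _))))
      ; closed = λ i → trans (cong₂ (jellyAdj H L) (dec-enc _) (dec-enc _)) (trans (jellyAdj-head _ _) (closed C i))
      }

    root↦root : ∀ σ v → proj₂ (onPairs σ (v , r)) ≡ r
    root↦root σ v with HamiltonianCycle.spanning ham v
    ... | i , refl = cycle-in-roots (mapCycle σ headCycle) i

    nonroot↦nonroot : ∀ σ {v x} → x ≢ r → proj₂ (onPairs σ (v , x)) ≢ r
    nonroot↦nonroot σ {v} {x} x≢r image-on-root = x≢r (begin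
      x                                                ≡⟨ cong proj₂ (onPairs-inverse σ (v , x)) ⟨
      proj₂ (onPairs (invAut σ) (w , y))               ≡⟨ cong (λ y′ → proj₂ (onPairs (invAut σ) (w , y′))) image-on-root ⟩
      proj₂ (onPairs (invAut σ) (w , r))               ≡⟨ root↦root (invAut σ) w ⟩
      r                                                ∎)
      where
      open ≡-Reasoning
      w : Fin n
      w = proj₁ (onPairs σ (v , x))

      y : Fin s
      y = proj₂ (onPairs σ (v , x))

    leg↦leg : ∀ σ v x → proj₁ (onPairs σ (v , x)) ≡ proj₁ (onPairs σ (v , r))
    leg↦leg σ v x = along (IsTree.connected (isTree L) r x) refl
      where
      w : Fin n
      w = proj₁ (onPairs σ (v , r))

      step : ∀ {y z} → Adj T y z → z ≢ r → proj₁ (onPairs σ (v , y)) ≡ proj₁ (onPairs σ (v , z))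
      step {y} {z} Tyz z≢r with proj₁ (onPairs σ (v , y)) ≟ proj₁ (onPairs σ (v , z))
      ... | yes same   = same
      ... | no differ = contradiction (proj₂ (cross-leg-edge (jellyEdge _ _ image-adj) differ)) (nonroot↦nonroot σ z≢r)
        where
        image-adj : jellyAdj H L (onPairs σ (v , y)) (onPairs σ (v , z)) ≡ true
        image-adj = trans (onPairs-adj σ (v , y) (v , z)) (trans (jellyAdj-leg v y z) Tyz)

      along : ∀ {y x} → Walk T y x → proj₁ (onPairs σ (v , y)) ≡ w → proj₁ (onPairs σ (v , x)) ≡ w
      along []                   y↦w = y↦w
      along (_∷_ {j = z} Tyz walk) y↦w with z ≟ r
      ... | yes refl = along walk refl
      ... | no z≢r  = along walk (trans (sym (step Tyz z≢r)) y↦w)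

    headMap : Aut J → Fin n → Fin n
    headMap σ v = proj₁ (onPairs σ (v , r))

    legMap : Aut J → Fin n → Fin s → Fin s
    legMap σ v x = proj₂ (onPairs σ (v , x))

    onPairs-split : ∀ σ v x → onPairs σ (v , x) ≡ (headMap σ v , legMap σ v x)
    onPairs-split σ v x = cong₂ _,_ (leg↦leg σ v x) refl

    onPairs-root : ∀ σ v → onPairs σ (v , r) ≡ (headMap σ v , r)
    onPairs-root σ v = cong₂ _,_ refl (root↦root σ v)

    headMap-inverse : ∀ σ v → headMap (invAut σ) (headMap σ v) ≡ v
    headMap-inverse σ v = cong proj₁ (trans (cong (onPairs (invAut σ)) (sym (onPairs-root σ v))) (onPairs-inverse σ (v , r)))

    headAut : Aut J → Aut H
    headAut σ = record
      { fun     = headMap σ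
      ; inv     = headMap (invAut σ)
      ; inv-l   = headMap-inverse σ
      ; inv-r   = headMap-inverse (invAut σ)
      ; preserv = λ a b → begin
          H (headMap σ a) (headMap σ b)                          ≡⟨ jellyAdj-head _ _ ⟨
          jellyAdj H L (headMap σ a , r) (headMap σ b , r)       ≡⟨ cong₂ (jellyAdj H L) (onPairs-root σ a) (onPairs-root σ b) ⟨
          jellyAdj H L (onPairs σ (a , r)) (onPairs σ (b , r))   ≡⟨ onPairs-adj σ (a , r) (b , r) ⟩
          jellyAdj H L (a , r) (b , r)                           ≡⟨ jellyAdj-head a b ⟩
          H a b                                                  ∎
      }
      where open ≡-Reasoning

    legAut : Aut J → Fin n → Aut T
    legAut σ v = record
      { fun     = legMap σ v
      ; inv     = legMap (invAut σ) (headMap σ v)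
      ; inv-l   = λ x → cong proj₂ (trans (cong (onPairs (invAut σ)) (sym (onPairs-split σ v x))) (onPairs-inverse σ (v , x)))
      ; inv-r   = λ y → cong proj₂ (trans (cong (onPairs σ) (sym (back y))) (onPairs-inverse (invAut σ) (headMap σ v , y)))
      ; preserv = λ x y → begin
          T (legMap σ v x) (legMap σ v y)
            ≡⟨ jellyAdj-leg (headMap σ v) _ _ ⟨
          jellyAdj H L (headMap σ v , legMap σ v x) (headMap σ v , legMap σ v y)
            ≡⟨ cong₂ (jellyAdj H L) (onPairs-split σ v x) (onPairs-split σ v y) ⟨
          jellyAdj H L (onPairs σ (v , x)) (onPairs σ (v , y))
            ≡⟨ onPairs-adj σ (v , x) (v , y) ⟩
          jellyAdj H L (v , x) (v , y)
            ≡⟨ jellyAdj-leg v x y ⟩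
          T x y
            ∎
      }
      where
      open ≡-Reasoning
      back : ∀ y → onPairs (invAut σ) (headMap σ v , y) ≡ (v , legMap (invAut σ) (headMap σ v) y)
      back y = trans (onPairs-split (invAut σ) (headMap σ v) y) (cong₂ _,_ (headMap-inverse σ v) refl)

    legAut-root : ∀ σ v → RootFixing L (legAut σ v)
    legAut-root = root↦root

    fixing-set-at-roots : Rigid L → ∀ {S₀} → IsFixingSet H S₀ → IsFixingSet J (S₀ ⊗ ⁅ r ⁆)
    fixing-set-at-roots L-rigid {S₀} S₀-fixes σ _ σ-fixes = identity-onPairs σ λ (v , x) →
      trans (onPairs-split σ v x) (cong₂ _,_ (head-id v) (L-rigid (legAut σ v) (legAut-root σ v) x))
      where
      head-id : ∀ v → headMap σ v ≡ v
      head-id = S₀-fixes (headAut σ) tt λ v v∈S₀ →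
        cong proj₁ (onPairs-fixed σ (v , r) (σ-fixes _ (∈-⊗⁺ v∈S₀ (x∈⁅x⁆ r))))

    fixing-set-in-legs : ∀ {T₀} → Nonempty T₀ → IsFixingSetWrt T (RootFixing L) T₀ → IsFixingSet J (⊤ {n} ⊗ T₀)
    fixing-set-in-legs {T₀} (t , t∈T₀) T₀-fixes σ _ σ-fixes = identity-onPairs σ λ (v , x) →
      trans (onPairs-split σ v x) (cong₂ _,_ (head-id v) (leg-id v x))
      where
      fixed : ∀ v {x} → x ∈ T₀ → onPairs σ (v , x) ≡ (v , x)
      fixed v x∈T₀ = onPairs-fixed σ (v , _) (σ-fixes _ (∈-⊗⁺ (∈⊤ {x = v}) x∈T₀))

      head-id : ∀ v → headMap σ v ≡ v
      head-id v = trans (sym (leg↦leg σ v t)) (cong proj₁ (fixed v t∈T₀))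

      leg-id : ∀ v x → legMap σ v x ≡ x
      leg-id v = T₀-fixes (legAut σ v) (legAut-root σ v) (λ x x∈T₀ → cong proj₂ (fixed v x∈T₀))

    rigid-case : Rigid L → ∀ k → IsFix H k → IsFix J k
    rigid-case L-rigid k ((S₀ , S₀-fixes , ∣S₀∣≡k) , S₀-minimal) =
      (S₀ ⊗ ⁅ r ⁆ , fixing-set-at-roots L-rigid S₀-fixes , ∣S₀⊗r∣≡k) ,
      λ S S-fixes → ≤-trans (S₀-minimal (shadow S) (shadow-fixing S-fixes)) (∣shadow∣≤∣S∣ S)
      where
      ∣S₀⊗r∣≡k : ∣ S₀ ⊗ ⁅ r ⁆ ∣ ≡ k
      ∣S₀⊗r∣≡k = trans (∣P⊗Q∣≡∣P∣*∣Q∣ S₀ ⁅ r ⁆)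
        (trans (cong (∣ S₀ ∣ *_) (∣⁅x⁆∣≡1 r)) (trans (*-identityʳ _) ∣S₀∣≡k))

    nonrigid-case : ¬ Rigid L → ∀ k → IsFixRooted L k → IsFix J (n * k)
    nonrigid-case L-nonrigid k ((T₀ , T₀-fixes , ∣T₀∣≡k) , T₀-minimal) =
      (⊤ {n} ⊗ T₀ , fixing-set-in-legs (fixing-set-nonempty {L = L} L-nonrigid T₀-fixes) T₀-fixes , ∣⊤⊗T₀∣≡n*k) ,
      λ S S-fixes → n*k≤∣S∣ S (λ v → T₀-minimal (slice S v) (slice-fixing S-fixes v))
      where
      ∣⊤⊗T₀∣≡n*k : ∣ ⊤ {n} ⊗ T₀ ∣ ≡ n * k
      ∣⊤⊗T₀∣≡n*k = trans (∣P⊗Q∣≡∣P∣*∣Q∣ (⊤ {n}) T₀) (cong₂ _*_ (∣⊤∣≡n n) ∣T₀∣≡k)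

theorem5 : ∀ {n : ℕ} (H : Graph n) → IsSimple H → HamiltonianCycle H → (L : RootedTree) →
    (Rigid L → ∀ k → IsFix H k → IsFix (jellyfish H L) k)
    × (¬ Rigid L → ∀ k → IsFixRooted L k → IsFix (jellyfish H L) (n * k))
theorem5 H H-simple ham L = rigid-case ham , nonrigid-case ham
  where open Jellyfish H H-simple L
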